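{- Let $k\in\mathbb{Z}_{>0}$ and $a\in\frac{k}{2}+\mathbb{Z}$ with $a\ge 0$. Write $q=e^{2\pi i\tau}$ ($\tau$ in the upper half-plane) and $\zeta=e^{2\pi i z}$, and let $$F_k(z;\tau):=\left(\frac{ -\vartheta\left(z+\frac12;\tau\right)}{q^{\frac1{12}}\eta(\tau)}\right)^k .$$ Then the $\zeta^a$-coefficient of $F_k(z;\tau)$ (i.e. the coefficient of $e^{2\pi i a z}$ in its expansion) is $$C\Psi_{k,a}(q)=\sum_{n\ge 0}c\psi_{k,a}(n)q^n,$$ where $c\psi_{k,a}(n)$ is the number of $(k,a)$-colored F-partitions of weight $n$. In particular $C\Psi_{k,k/2}(q)=C\Phi_k(q)$.
   Context: $\vartheta(z;\tau):=\sum_{n\in\frac12+\mathbb{Z}}e^{\pi i n^2\tau+2\pi i n(z+\frac12)}$ for $z\in\mathbb{C}$, $\tau$ in the upper half-plane; $\eta(\tau)=q^{1/24}\prod_{n\ge1}(1-q^n)$; $q^x:=e^{2\pi i x\tau}$ for rational $x$. Colored integers: an entry is a pair $m_j$ consisting of a nonnegative integer $m$ and a color $j\in\{1,\dots,k\}$ (i.e. it lies in the $j$-th of $k$ copies of $\mathbb{Z}_{\ge0}$). They are ordered lexicographically: $m_j<n_\ell$ iff $m<n$, or $m=n$ and $j<\ell$. A $(k,a)$-colored F-partition is a two-rowed array $\begin{pmatrix}a_1&\cdots&a_r\\ b_1&\cdots&b_s\end{pmatrix}$ ($r,s\ge0$) whose entries are colored nonnegative integers, each row strictly decreasing in the lexicographic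 order, with $r-s=a-\frac{k}{2}$. Its weight is $r+\sum_{\ell=1}^r a_\ell+\sum_{j=1}^s b_j$ (the values, not colors, are summed). $c\psi_{k,a}(n)$ is the number of such arrays of weight $n$. A $k$-colored Frobenius partition of $n$ is such an array with $r=s$ and weight $n$ (i.e. the case $a=k/2$); $c\phi_k(n)$ counts them (with $c\phi_k(0)=1$ from the empty array) and $C\Phi_k(q):=\sum_{n\ge0}c\phi_k(n)q^n$. -}

module Defs where

open import Data.Nat using (ℕ; zero; suc; _+_; _*_; _∸_; _<_; _≡ᵇ_; _/_)
open import Data.Integer as ℤ using (ℤ; +_; ∣_∣)
open import Data.Fin using (Fin; toℕ)
open import Data.List using (List; map; upTo; length)
open import Data.Nat.ListAction using (sum)
open import Data.List.Relation.Unary.Linked using (Linked)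
open import Data.Product using (_×_; _,_; proj₁)
open import Data.Sum using (_⊎_)
open import Data.Bool using (if_then_else_)
open import Relation.Nullary.Decidable using (does)
open import Relation.Binary.PropositionalEquality using (_≡_)

sumTo : ℕ → (ℕ → ℕ) → ℕ
sumTo n f = sum (map f (upTo (suc n)))

sumℤ : ℕ → (ℤ → ℕ) → ℕ
sumℤ R f = sum (map (λ i → f ((+ i) ℤ.- (+ R))) (upTo (suc (2 * R))))

-- Formal expansion of F_k(z;τ).
-- Exponents of ζ are recorded DOUBLED (an integer e stands for ζ^{e/2}),
-- exponents of q are natural numbers.
--
-- -ϑ(z+1/2;τ) = Σ_{ν ∈ 1/2+ℤ} q^{ν²/2} ζ^ν   (since e^{2πiν} = -1),
-- and q^{1/12} η(τ) = q^{1/8} ∏_{m≥1}(1-q^m).  Hence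
-- -ϑ(z+1/2;τ)/q^{1/8} = Σ_{d odd} q^{(d²-1)/8} ζ^{d/2}.
-- thetaCoeff d n = coefficient of ζ^{d/2} q^n in -ϑ(z+1/2;τ)/q^{1/8}.

thetaCoeff : ℤ → ℕ → ℕ
thetaCoeff d n = if (∣ d ∣ * ∣ d ∣) ≡ᵇ (8 * n + 1) then 1 else 0

-- coefficient of ζ^{e/2} q^n in (-ϑ(z+1/2;τ)/q^{1/8})^k  (Cauchy product;
-- only d with |d| ≤ 8n+1 and q-exponent t ≤ n can contribute)
thetaPowCoeff : ℕ → ℤ → ℕ → ℕ
thetaPowCoeff zero    e n = if does (e ℤ.≟ + 0) then (if n ≡ᵇ 0 then 1 else 0) else 0
thetaPowCoeff (suc k) e n =
  sumTo n (λ t → sumℤ (8 * n + 1) (λ d →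
    thetaCoeff d t * thetaPowCoeff k (e ℤ.- d) (n ∸ t)))

-- coefficient of q^n in ∏_{m=1}^{i} 1/(1-q^m) = Σ_{m=1}^{i} Σ_{t≥0} q^{m t} products
partsUpTo : ℕ → ℕ → ℕ
partsUpTo zero    n = if n ≡ᵇ 0 then 1 else 0
partsUpTo (suc i) n = sumTo (n / suc i) (λ t → partsUpTo i (n ∸ t * suc i))

-- coefficient of q^n in 1/∏_{m≥1}(1-q^m)  (factors with m > n do not matter)
invEulerCoeff : ℕ → ℕ
invEulerCoeff n = partsUpTo n n

invEulerPowCoeff : ℕ → ℕ → ℕ
invEulerPowCoeff zero    n = if n ≡ᵇ 0 then 1 else 0
invEulerPowCoeff (suc k) n = sumTo n (λ t → invEulerCoeff t * invEulerPowCoeff k (n ∸ t))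

-- Fcoeff k a2 n = coefficient of ζ^{a2/2} q^n in
--   F_k(z;τ) = ( -ϑ(z+1/2;τ) / (q^{1/12} η(τ)) )^k
--            = (-ϑ(z+1/2;τ)/q^{1/8})^k · (∏(1-q^m))^{-k}.
Fcoeff : ℕ → ℕ → ℕ → ℕ
Fcoeff k a2 n = sumTo n (λ t → thetaPowCoeff k (+ a2) t * invEulerPowCoeff k (n ∸ t))

-- m_j with value m and color j ∈ {1..k} (Fin k, colors shifted by one)
ColInt : ℕ → Set
ColInt k = ℕ × Fin k

_<ᶜ_ : ∀ {k} → ColInt k → ColInt k → Set
(m , j) <ᶜ (n , l) = (m < n) ⊎ (m ≡ n × toℕ j < toℕ l)

StrictDec : ∀ {k} → List (ColInt k) → Set
StrictDec {k} = Linked (λ x y → y <ᶜ x)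

rowSum : ∀ {k} → List (ColInt k) → ℕ
rowSum xs = sum (map proj₁ xs)

-- (k,a)-colored F-partitions of weight n, where a = a2/2.
-- The condition r - s = a - k/2 is written 2r + k = 2s + a2.
record FPart (k a2 n : ℕ) : Set where
  field
    top    : List (ColInt k)
    bottom : List (ColInt k)
    topDec : StrictDec top
    botDec : StrictDec bottom
    balance : 2 * length top + k ≡ 2 * length bottom + a2
    weight  : length top + rowSum top + rowSum bottom ≡ n

record CFrob (k n : ℕ) : Set where
  field
    top    : List (ColInt k)
    bottom : List (ColInt k)
    topDec : StrictDec top
    botDec : StrictDec bottom
    balance : length top ≡ length bottom
    weight  : length top + rowSum top + rowSum bottom ≡ n

-- F_k is the k-th power of Σ_{c ∈ ℤ} ζ^{c+1/2} q^{c(c+1)/2} / ∏_{m ≥ 1} (1 - q^m), so its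
-- ζ^a q^n-coefficient counts k-tuples of pairs (c, λ), c ∈ ℤ and λ a partition, with Σ (2c + 1) = 2a
-- and Σ (c(c+1)/2 + |λ|) = n. An F-partition of weight n splits by colour into k pairs of sets
-- (top values, bottom values) ⊆ [0, n], i.e. Maya diagrams, whose charges (#top - #bottom) and
-- weights add up. The combinatorial Jacobi triple product matches diagrams of charge c and weight w
-- with partitions of w - c(c+1)/2: translating a diagram by one site lowers its charge by one and
-- its weight by the charge, and diagrams of charge 0 obey the recursion of partitions into bounded
-- parts.

module Submission where

open import Defs
open import Axiom.UniquenessOfIdentityProofs.WithK using (uip)
open import Data.Bool using (Bool; true; false; not; if_then_else_; T)
open import Data.Bool.Properties using (not-involutive)
open import Data.Empty using (⊥; ⊥-elim)
open import Data.Fin using (Fin; toℕ; fromℕ<) renaming (zero to fzero; suc to fsuc)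
open import Data.Fin.Properties using (+↔⊎; *↔×; toℕ<n; toℕ-fromℕ<; fromℕ<-toℕ; toℕ-injective)
open import Data.Integer as ℤ using (ℤ; +_; -[1+_]; ∣_∣)
import Data.Integer.Properties as ℤ
open import Data.Integer.Tactic.RingSolver using (solve-∀)
import Data.Nat.Tactic.RingSolver as ℕ-Ring
open import Data.List using (List; []; _∷_; map; applyUpTo; length)
open import Data.List.Relation.Unary.Linked using ([]; [-]; _∷_)
open import Data.List.Properties using (map-applyUpTo; map-cong)
open import Data.Nat
open import Data.Nat.DivMod using (m/n≡1+[m∸n]/n; m<n⇒m/n≡0)
open import Data.Nat.ListAction using (sum)
open import Data.Nat.Properties
import Algebra.Properties.CommutativeSemigroup
open import Data.Product using (Σ; ∃; ∃-syntax; _×_; _,_; proj₁; proj₂)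
open import Data.Product.Function.Dependent.Propositional using (Σ-↔)
open import Data.Product.Function.NonDependent.Propositional using (_×-↔_)
open import Data.Sum using (_⊎_; inj₁; inj₂)
open import Data.Sum.Function.Propositional using (_⊎-↔_)
open import Data.Unit using (⊤; tt)
open import Data.Vec using (Vec; []; _∷_; _∷ʳ_; init; last; initLast; replicate; head; tail; zipWith)
import Data.Vec as Vec
open import Data.Vec.Properties using (×v↔v×; init-∷ʳ; last-∷ʳ)
open import Function using (_∘_; id)
open import Function.Bundles using (_↔_; mk↔ₛ′; Inverse)
open import Function.Properties.Inverse using (↔-refl; ↔-sym; ↔-trans)
open import Function.Related.TypeIsomorphisms using (Σ-assoc; ∃-≡)
open import Relation.Binary.PropositionalEquality
open import Relation.Nullary using (¬_; yes; no)
open import Relation.Nullary.Irrelevant using (Irrelevant)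

open import Algebra.Properties.CommutativeSemigroup +-commutativeSemigroup
  using () renaming (interchange to +-interchange)
module ℤ+ = Algebra.Properties.CommutativeSemigroup ℤ.+-commutativeSemigroup
open import Algebra.Properties.AbelianGroup ℤ.+-0-abelianGroup
  using () renaming (∙-cancelˡ to ℤ+-cancelˡ; ∙-cancelʳ to ℤ+-cancelʳ)

open Inverse using (to; from; strictlyInverseˡ; strictlyInverseʳ)

private
  variable
    A B C : Set
    P Q X Y : A → Set

infixr 0 _⨾_
_⨾_ : A ↔ B → B ↔ C → A ↔ C
_⨾_ = ↔-trans

subst-↔ : ∀ (P : A → Set) {x y} → x ≡ y → P x ↔ P y
subst-↔ P refl = ↔-refl

↔-irrelevant : (A → B) → (B → A) → Irrelevant A → Irrelevant B → A ↔ B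
↔-irrelevant f g irrA irrB = mk↔ₛ′ f g (λ _ → irrB _ _) (λ _ → irrA _ _)

≡×≡-irrelevant : ∀ {a b : A} {c d : B} → Irrelevant (a ≡ b × c ≡ d)
≡×≡-irrelevant (p , q) (p′ , q′) = cong₂ _,_ (uip p p′) (uip q q′)

Σ-↔′ : (∀ a → P a ↔ Q a) → Σ A P ↔ Σ A Q
Σ-↔′ f = Σ-↔ ↔-refl (f _)

Σ-×-↔ : (∀ a → P a → X a ↔ Y a) → Σ A (λ a → P a × X a) ↔ Σ A (λ a → P a × Y a)
Σ-×-↔ f = Σ-↔′ (λ a → Σ-↔′ (f a))

Σ-↔-irrelevant : (e : A ↔ B) → (∀ a → P a → Q (to e a)) → (∀ b → Q b → P (from e b)) →
  (∀ a → Irrelevant (P a)) → (∀ b → Irrelevant (Q b)) → Σ A P ↔ Σ B Q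
Σ-↔-irrelevant {P = P} e f g irrP irrQ = Σ-↔ e (λ {a} →
  ↔-irrelevant (f a) (λ q → subst P (strictlyInverseʳ e a) (g (to e a) q)) (irrP a) (irrQ (to e a)))

⊎-empty : ¬ B → (A ⊎ B) ↔ A
⊎-empty ¬b = mk↔ₛ′ (λ { (inj₁ a) → a ; (inj₂ b) → ⊥-elim (¬b b) }) inj₁ (λ _ → refl)
  (λ { (inj₁ a) → refl ; (inj₂ b) → ⊥-elim (¬b b) })

empty-↔ : ¬ A → ¬ B → A ↔ B
empty-↔ ¬a ¬b = mk↔ₛ′ (⊥-elim ∘ ¬a) (⊥-elim ∘ ¬b) (⊥-elim ∘ ¬b) (⊥-elim ∘ ¬a)

∷-↔ : ∀ {n} → (A × Vec A n) ↔ Vec A (suc n)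
∷-↔ = mk↔ₛ′ (λ (x , xs) → x ∷ xs) (λ { (x ∷ xs) → x , xs }) (λ { (x ∷ xs) → refl }) (λ { (x , xs) → refl })

Fin-if-≡ᵇ : ∀ m n → Fin (if m ≡ᵇ n then 1 else 0) ↔ (m ≡ n)
Fin-if-≡ᵇ m n with m ≡ᵇ n in eq
... | true  = ↔-irrelevant (λ _ → ≡ᵇ⇒≡ m n (subst T (sym eq) tt)) (λ _ → fzero)
                (λ { fzero fzero → refl ; fzero (fsuc ()) ; (fsuc ()) _ }) uip
... | false = ↔-irrelevant (λ ()) (λ m≡n → ⊥-elim (subst T eq (≡⇒≡ᵇ m n m≡n))) (λ ()) uip

Fin-* : ∀ {m n} → Fin m ↔ A → Fin n ↔ B → Fin (m * n) ↔ (A × B)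
Fin-* f g = *↔× ⨾ f ×-↔ g

Σ-Fin-suc : ∀ {m} {P : Fin (suc m) → Set} → Σ (Fin (suc m)) P ↔ (P fzero ⊎ Σ (Fin m) (P ∘ fsuc))
Σ-Fin-suc = mk↔ₛ′ (λ { (fzero , p) → inj₁ p ; (fsuc i , p) → inj₂ (i , p) })
  (λ { (inj₁ p) → fzero , p ; (inj₂ (i , p)) → fsuc i , p })
  (λ { (inj₁ p) → refl ; (inj₂ (i , p)) → refl }) (λ { (fzero , p) → refl ; (fsuc i , p) → refl })

Fin-sum-applyUpTo : ∀ (f g : ℕ → ℕ) m →
  Fin (sum (map f (applyUpTo g m))) ↔ Σ (Fin m) (λ i → Fin (f (g (toℕ i))))
Fin-sum-applyUpTo f g zero    = mk↔ₛ′ (λ ()) (λ ()) (λ ()) (λ ())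
Fin-sum-applyUpTo f g (suc m) =
  +↔⊎ ⨾ ↔-refl ⊎-↔ Fin-sum-applyUpTo f (g ∘ suc) m ⨾ ↔-sym Σ-Fin-suc

Fin-suc↔≤ : ∀ n → Fin (suc n) ↔ Σ ℕ (_≤ n)
Fin-suc↔≤ n = mk↔ₛ′ (λ i → toℕ i , ≤-pred (toℕ<n i)) (λ (t , t≤n) → fromℕ< (s≤s t≤n))
  (λ (t , t≤n) → to≤ (toℕ-fromℕ< (s≤s t≤n)))
  (λ i → fromℕ<-toℕ i _)
  where
  to≤ : ∀ {t t′} {p : t ≤ n} {p′ : t′ ≤ n} → t′ ≡ t → _≡_ {A = Σ ℕ (_≤ n)} (t′ , p′) (t , p)
  to≤ refl = cong (_ ,_) (≤-irrelevant _ _)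

Fin-sumTo : ∀ n (f : ℕ → ℕ) → Fin (sumTo n f) ↔ Σ ℕ (λ t → t ≤ n × Fin (f t))
Fin-sumTo n f = Fin-sum-applyUpTo f id (suc n) ⨾ Σ-↔ (Fin-suc↔≤ n) ↔-refl ⨾ Σ-assoc

Σ-reindex : ∀ {A B : Set} {P : B → Set} (g : A → B) → (∀ a a′ → g a ≡ g a′ → a ≡ a′) →
  (∀ b → P b → ∃[ a ] g a ≡ b) → Σ A (P ∘ g) ↔ Σ B P
Σ-reindex {A = A} {B = B} {P = P} g g-inj cover = mk↔ₛ′ (λ (a , p) → g a , p) back
  (λ (b , p) → lift (proj₂ (cover b p)) p)
  (λ (a , p) → drop (g-inj _ _ (proj₂ (cover (g a) p))) (proj₂ (cover (g a) p)) p)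
  where
  back : Σ B P → Σ A (P ∘ g)
  back (b , p) = proj₁ (cover b p) , subst P (sym (proj₂ (cover b p))) p
  lift : ∀ {a b} (e : g a ≡ b) (p : P b) → _≡_ {A = Σ B P} (g a , subst P (sym e) p) (b , p)
  lift refl p = refl
  drop : ∀ {a a′} → a′ ≡ a → (e : g a′ ≡ g a) (p : P (g a)) →
    _≡_ {A = Σ A (P ∘ g)} (a′ , subst P (sym e) p) (a , p)
  drop refl e p rewrite uip e refl = refl

Fin-sumℤ : ∀ R (f : ℤ → ℕ) → (∀ d → Fin (f d) → ∣ d ∣ ≤ R) → Fin (sumℤ R f) ↔ Σ ℤ (Fin ∘ f)
Fin-sumℤ R f support =
  Fin-sum-applyUpTo (λ i → f (+ i ℤ.- + R)) id (suc (2 * R)) ⨾ Σ-reindex offset offset-injective cover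
  where
  offset : Fin (suc (2 * R)) → ℤ
  offset i = + toℕ i ℤ.- + R
  offset-injective : ∀ i j → offset i ≡ offset j → i ≡ j
  offset-injective i j eq = toℕ-injective (ℤ.+-injective (ℤ+-cancelʳ (ℤ.- + R) _ _ eq))
  R≤2R : R ≤ 2 * R
  R≤2R = m≤m+n R (R + 0)
  shift-forth : ∀ a b → (a ℤ.+ b) ℤ.- b ≡ a
  shift-forth = solve-∀
  shift-back : ∀ a b → a ℤ.- (a ℤ.+ b) ≡ ℤ.- b
  shift-back = solve-∀
  cover : ∀ d → Fin (f d) → ∃[ i ] offset i ≡ d
  cover (+ m) x = fromℕ< (s≤s (+-mono-≤ (support (+ m) x) (m≤m+n R 0))) ,
    trans (cong (λ i → + i ℤ.- + R) (toℕ-fromℕ< _)) (shift-forth (+ m) (+ R))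
  cover -[1+ m ] x = fromℕ< (s≤s (≤-trans (m∸n≤m R (suc m)) R≤2R)) , (begin
    + toℕ (fromℕ< _) ℤ.- + R
      ≡⟨ cong (λ i → + i ℤ.- + R) (toℕ-fromℕ< _) ⟩
    + (R ∸ suc m) ℤ.- + R
      ≡⟨ cong (λ r → + (R ∸ suc m) ℤ.- + r) (m∸n+n≡m (support _ x)) ⟨
    + (R ∸ suc m) ℤ.- (+ (R ∸ suc m) ℤ.+ + suc m)
      ≡⟨ shift-back (+ (R ∸ suc m)) (+ suc m) ⟩
    -[1+ m ] ∎)
    where open ≡-Reasoning

Shifted : ℕ → (ℕ → Set) → ℕ → Set
Shifted a X w = Σ ℕ (λ u → a + u ≡ w × X u)

shifted-≤ : ∀ {a u w} → a + u ≡ w → u ≤ w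
shifted-≤ {a} {u} refl = m≤n+m u a

shifted-< : ∀ {a u w} → suc a + u ≡ w → u < w
shifted-< {a} {u} refl = s≤s (m≤n+m u a)

Shifted-↔ : ∀ a {w} → (∀ u → a + u ≡ w → X u ↔ Y u) → Shifted a X w ↔ Shifted a Y w
Shifted-↔ a = Σ-×-↔

Shifted-zero : ∀ {X : ℕ → Set} {w} → Shifted 0 X w ↔ X w
Shifted-zero {X = X} = ↔-sym (∃-≡ X)

Shifted-∸ : ∀ {X : ℕ → Set} {a w} → a ≤ w → X (w ∸ a) ↔ Shifted a X w
Shifted-∸ {X = X} {a} a≤w = ∃-≡ X ⨾ Σ-↔′ (λ u →
  ↔-irrelevant (λ { refl → m+[n∸m]≡n a≤w }) (λ { refl → sym (m+n∸m≡n a u) }) uip uip ×-↔ ↔-refl)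

Shifted-empty : ∀ {X : ℕ → Set} {a w} → w < a → ¬ Shifted a X w
Shifted-empty {a = a} w<a (u , refl , _) = <⇒≱ w<a (m≤m+n a u)

Shifted-+ : ∀ {X : ℕ → Set} a b {w} → Shifted a (Shifted b X) w ↔ Shifted (a + b) X w
Shifted-+ a b = mk↔ₛ′
  (λ { (_ , a+v≡w , u , refl , x) → u , trans (+-assoc a b u) a+v≡w , x })
  (λ { (u , e , x) → b + u , trans (sym (+-assoc a b u)) e , u , refl , x })
  (λ { (u , e , x) → cong (λ e′ → u , e′ , x) (uip _ _) })
  (λ { (_ , e , u , refl , x) → cong (λ e′ → b + u , e′ , u , refl , x) (uip _ _) })

-- Sets graded by a charge in ℤ (doubled ζ-exponent) and a weight in ℕ (q-exponent)

record Graded : Set₁ where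
  field
    Carrier : Set
    charge  : Carrier → ℤ
    weight  : Carrier → ℕ
open Graded public

Fibre : Graded → ℤ → ℕ → Set
Fibre X e n = Σ (Carrier X) (λ x → charge X x ≡ e × weight X x ≡ n)

Fibre-↔ : ∀ {X Y e n} (f : Carrier X ↔ Carrier Y) → (∀ x → charge Y (to f x) ≡ charge X x) →
  (∀ x → weight Y (to f x) ≡ weight X x) → Fibre X e n ↔ Fibre Y e n
Fibre-↔ {X} {Y} f charge-to weight-to = Σ-↔-irrelevant f
  (λ x (c , w) → trans (charge-to x) c , trans (weight-to x) w)
  (λ y (c , w) → trans (sym (charge-to (from f y))) (trans (cong (charge Y) (strictlyInverseˡ f y)) c) ,
                 trans (sym (weight-to (from f y))) (trans (cong (weight Y) (strictlyInverseˡ f y)) w))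
  (λ _ → ≡×≡-irrelevant) (λ _ → ≡×≡-irrelevant)

Fibre-Shifted : ∀ {X e} a w →
  Σ (Carrier X) (λ x → charge X x ≡ e × a + weight X x ≡ w) ↔ Shifted a (Fibre X e) w
Fibre-Shifted {X} a w = mk↔ₛ′ (λ (x , c , e) → weight X x , e , x , c , refl)
  (λ { (_ , e , x , c , refl) → x , c , e }) (λ { (_ , e , x , c , refl) → refl }) (λ { (x , c , e) → refl })

_⊗_ : Graded → Graded → Graded
X ⊗ Y = record
  { Carrier = Carrier X × Carrier Y
  ; charge  = λ (x , y) → charge X x ℤ.+ charge Y y
  ; weight  = λ (x , y) → weight X x + weight Y y
  }

Σcharge : ∀ X {k} → Vec (Carrier X) k → ℤ
Σcharge X []       = + 0
Σcharge X (x ∷ xs) = charge X x ℤ.+ Σcharge X xs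

Σweight : ∀ X {k} → Vec (Carrier X) k → ℕ
Σweight X []       = 0
Σweight X (x ∷ xs) = weight X x + Σweight X xs

_⊗^_ : Graded → ℕ → Graded
X ⊗^ k = record { Carrier = Vec (Carrier X) k ; charge = Σcharge X ; weight = Σweight X }

Fibre-⊗^-zero : ∀ {X e n} → Fibre (X ⊗^ 0) e n ↔ (e ≡ + 0 × n ≡ 0)
Fibre-⊗^-zero = ↔-irrelevant (λ { ([] , c , w) → sym c , sym w }) (λ (c , w) → [] , sym c , sym w)
  (λ { ([] , p) ([] , q) → cong ([] ,_) (≡×≡-irrelevant p q) }) ≡×≡-irrelevant

Fibre-⊗^-suc : ∀ {X k e n} → Fibre (X ⊗^ suc k) e n ↔ Fibre (X ⊗ (X ⊗^ k)) e n
Fibre-⊗^-suc = Fibre-↔ (↔-sym ∷-↔) (λ { (x ∷ xs) → refl }) (λ { (x ∷ xs) → refl })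

Convolution : Graded → Graded → ℤ → ℕ → Set
Convolution X Y e n = Σ ℕ (λ t → t ≤ n × Σ ℤ (λ d → Fibre X d t × Fibre Y (e ℤ.- d) (n ∸ t)))

Fibre-⊗ : ∀ X Y e n → Fibre (X ⊗ Y) e n ↔ Convolution X Y e n
Fibre-⊗ X Y e n = mk↔ₛ′ split join
  (λ { (_ , _ , _ , (x , refl , refl) , (y , c , w)) →
         cong₂ (λ le cw → _ , le , _ , (x , refl , refl) , (y , cw))
               (≤-irrelevant _ _) (≡×≡-irrelevant _ _) })
  (λ { ((x , y) , _) → cong ((x , y) ,_) (≡×≡-irrelevant _ _) })
  where
  cancel : ∀ a b → (a ℤ.+ b) ℤ.- a ≡ b
  cancel = solve-∀
  uncancel : ∀ a e → a ℤ.+ (e ℤ.- a) ≡ e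
  uncancel = solve-∀
  split : Fibre (X ⊗ Y) e n → Convolution X Y e n
  split ((x , y) , c , w) =
    weight X x , subst (weight X x ≤_) w (m≤m+n _ _) , charge X x , (x , refl , refl) ,
    y , trans (sym (cancel (charge X x) (charge Y y))) (cong (ℤ._- charge X x) c) ,
        trans (sym (m+n∸m≡n (weight X x) (weight Y y))) (cong (_∸ weight X x) w)
  join : Convolution X Y e n → Fibre (X ⊗ Y) e n
  join (_ , t≤n , _ , (x , refl , refl) , (y , c , w)) =
    (x , y) , trans (cong (λ z → charge X x ℤ.+ z) c) (uncancel (charge X x) e) ,
              trans (cong (λ z → weight X x + z) w) (m+[n∸m]≡n t≤n)

Convolution-↔ : ∀ {X X′ Y Y′} e n → (∀ d t → t ≤ n → Fibre X d t ↔ Fibre X′ d t) →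
  (∀ d u → u ≤ n → Fibre Y d u ↔ Fibre Y′ d u) → Convolution X Y e n ↔ Convolution X′ Y′ e n
Convolution-↔ e n fX fY = Σ-×-↔ (λ t t≤n → Σ-↔′ (λ d → fX d t t≤n ×-↔ fY _ _ (m∸n≤m n t)))

Fibre-⊗^-↔ : ∀ {X Y} n → (∀ e w → w ≤ n → Fibre X e w ↔ Fibre Y e w) →
  ∀ k e w → w ≤ n → Fibre (X ⊗^ k) e w ↔ Fibre (Y ⊗^ k) e w
Fibre-⊗^-↔ n f zero    e w w≤n = Fibre-⊗^-zero ⨾ ↔-sym Fibre-⊗^-zero
Fibre-⊗^-↔ {X} {Y} n f (suc k) e w w≤n =
  Fibre-⊗^-suc ⨾ Fibre-⊗ X (X ⊗^ k) e w ⨾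
  Convolution-↔ e w (λ d t t≤w → f d t (≤-trans t≤w w≤n))
                    (λ d u u≤w → Fibre-⊗^-↔ n f k d u (≤-trans u≤w w≤n)) ⨾
  ↔-sym (Fibre-⊗ Y (Y ⊗^ k) e w) ⨾ ↔-sym Fibre-⊗^-suc

Fibre-uncharged : ∀ {X Y} → (∀ y → charge Y y ≡ + 0) → ∀ e t u →
  (Fibre X e t × Fibre Y (+ 0) u) ↔ Σ ℤ (λ d → Fibre X d t × Fibre Y (e ℤ.- d) u)
Fibre-uncharged {X} {Y} uncharged e t u = mk↔ₛ′ spread concentrate
  (λ { (d , fx , y , c , w) → spread∘concentrate d fx y c w (charge-is-e d y c) })
  (λ { (fx , y , c , w) → concentrate∘spread fx y c w })
  where
  charge-is-e : ∀ d y → charge Y y ≡ e ℤ.- d → e ≡ d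
  charge-is-e d y c = ℤ.i-j≡0⇒i≡j e d (trans (sym c) (uncharged y))
  spread : Fibre X e t × Fibre Y (+ 0) u → Σ ℤ (λ d → Fibre X d t × Fibre Y (e ℤ.- d) u)
  spread (fx , y , c , w) = e , fx , y , trans c (sym (ℤ.+-inverseʳ e)) , w
  concentrate : Σ ℤ (λ d → Fibre X d t × Fibre Y (e ℤ.- d) u) → Fibre X e t × Fibre Y (+ 0) u
  concentrate (d , fx , y , c , w) =
    subst (λ d → Fibre X d t) (sym (charge-is-e d y c)) fx , y , uncharged y , w
  concentrate∘spread : ∀ fx y c w → concentrate (spread (fx , y , c , w)) ≡ (fx , y , c , w)
  concentrate∘spread fx y c w rewrite uip (charge-is-e e y (trans c (sym (ℤ.+-inverseʳ e)))) refl =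
    cong (λ c′ → fx , y , c′ , w) (uip _ _)
  spread∘concentrate : ∀ d fx y c w → e ≡ d → spread (concentrate (d , fx , y , c , w)) ≡ (d , fx , y , c , w)
  spread∘concentrate d fx y c w refl rewrite uip (charge-is-e e y c) refl =
    cong (λ c′ → e , fx , y , c′ , w) (uip _ _)

Σcharge-zip : ∀ X Y {k} (xs : Vec (Carrier X) k) ys →
  Σcharge (X ⊗ Y) (Vec.zip xs ys) ≡ Σcharge X xs ℤ.+ Σcharge Y ys
Σcharge-zip X Y []       []       = refl
Σcharge-zip X Y (x ∷ xs) (y ∷ ys) =
  trans (cong (λ z → (charge X x ℤ.+ charge Y y) ℤ.+ z) (Σcharge-zip X Y xs ys))
  (ℤ+.interchange (charge X x) (charge Y y) (Σcharge X xs) (Σcharge Y ys))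

Σweight-zip : ∀ X Y {k} (xs : Vec (Carrier X) k) ys →
  Σweight (X ⊗ Y) (Vec.zip xs ys) ≡ Σweight X xs + Σweight Y ys
Σweight-zip X Y []       []       = refl
Σweight-zip X Y (x ∷ xs) (y ∷ ys) =
  trans (cong (λ z → (weight X x + weight Y y) + z) (Σweight-zip X Y xs ys))
  (+-interchange (weight X x) (weight Y y) (Σweight X xs) (Σweight Y ys))

Fibre-zip : ∀ X Y k e n → Fibre ((X ⊗^ k) ⊗ (Y ⊗^ k)) e n ↔ Fibre ((X ⊗ Y) ⊗^ k) e n
Fibre-zip X Y k e n =
  Fibre-↔ ×v↔v× (λ (xs , ys) → Σcharge-zip X Y xs ys) (λ (xs , ys) → Σweight-zip X Y xs ys)

Σcharge-uncharged : ∀ X → (∀ x → charge X x ≡ + 0) → ∀ {k} (xs : Vec (Carrier X) k) → Σcharge X xs ≡ + 0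
Σcharge-uncharged X uncharged []       = refl
Σcharge-uncharged X uncharged (x ∷ xs) = cong₂ ℤ._+_ (uncharged x) (Σcharge-uncharged X uncharged xs)

Fin-sumTo-uncharged : ∀ {X Y} n e (f g : ℕ → ℕ) → (∀ y → charge Y y ≡ + 0) →
  (∀ t → Fin (f t) ↔ Fibre X e t) → (∀ u → Fin (g u) ↔ Fibre Y (+ 0) u) →
  Fin (sumTo n (λ t → f t * g (n ∸ t))) ↔ Fibre (X ⊗ Y) e n
Fin-sumTo-uncharged {X} {Y} n e f g uncharged fX gY =
  Fin-sumTo n _ ⨾ Σ-×-↔ (λ t _ → Fin-* (fX t) (gY (n ∸ t)) ⨾ Fibre-uncharged uncharged e t (n ∸ t)) ⨾
  ↔-sym (Fibre-⊗ X Y e n)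

-- The theta series -ϑ(z+1/2)/q^{1/8} = Σ_{c ∈ ℤ} ζ^{(2c+1)/2} q^{c(c+1)/2}

triangle : ℕ → ℕ
triangle zero    = zero
triangle (suc m) = suc m + triangle m

-- The doubled exponent of ζ^{c+1/2}.
odd : ℤ → ℤ
odd (+ m)    = + suc (2 * m)
odd -[1+ m ] = -[1+ 2 * m ]

triangleℤ : ℤ → ℕ
triangleℤ (+ m)    = triangle m
triangleℤ -[1+ m ] = triangle m

Theta : Graded
Theta = record { Carrier = ℤ ; charge = odd ; weight = triangleℤ }

2*triangle : ∀ m → 2 * triangle m ≡ m * suc m
2*triangle zero    = refl
2*triangle (suc m) = begin
  2 * (suc m + triangle m)      ≡⟨ *-distribˡ-+ 2 (suc m) (triangle m) ⟩
  2 * suc m + 2 * triangle m    ≡⟨ cong (λ x → 2 * suc m + x) (2*triangle m) ⟩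
  2 * suc m + m * suc m         ≡⟨ *-distribʳ-+ (suc m) 2 m ⟨
  suc (suc m) * suc m           ≡⟨ *-comm (suc (suc m)) (suc m) ⟩
  suc m * suc (suc m)           ∎
  where open ≡-Reasoning

odd-square : ∀ m → suc (2 * m) * suc (2 * m) ≡ 8 * triangle m + 1
odd-square m = begin
  suc (2 * m) * suc (2 * m)   ≡⟨ expand m ⟩
  4 * (m * suc m) + 1         ≡⟨ cong (λ x → 4 * x + 1) (2*triangle m) ⟨
  4 * (2 * triangle m) + 1    ≡⟨ cong (_+ 1) (*-assoc 4 2 (triangle m)) ⟨
  8 * triangle m + 1          ∎
  where
  open ≡-Reasoning
  expand : ∀ m → suc (2 * m) * suc (2 * m) ≡ 4 * (m * suc m) + 1
  expand = ℕ-Ring.solve-∀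

even-square : ∀ m t → 2 * m * (2 * m) ≢ 8 * t + 1
even-square m t eq = even≢odd (m * (2 * m)) (4 * t) (trans (sym (*-assoc 2 m (2 * m))) (trans eq (regroup t)))
  where
  regroup : ∀ t → 8 * t + 1 ≡ suc (2 * (4 * t))
  regroup = ℕ-Ring.solve-∀

even-or-odd : ∀ n → (∃[ m ] n ≡ 2 * m) ⊎ (∃[ m ] n ≡ suc (2 * m))
even-or-odd zero = inj₁ (0 , refl)
even-or-odd (suc n) with even-or-odd n
... | inj₁ (m , refl) = inj₂ (m , refl)
... | inj₂ (m , refl) = inj₁ (suc m , cong suc (sym (+-suc m (m + 0))))

odd-injective : ∀ c c′ → odd c ≡ odd c′ → c ≡ c′
odd-injective (+ m)    (+ m′)    eq = cong +_ (*-cancelˡ-≡ m m′ 2 (suc-injective (ℤ.+-injective eq)))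
odd-injective -[1+ m ] -[1+ m′ ] eq = cong -[1+_] (*-cancelˡ-≡ m m′ 2 (ℤ.-[1+-injective eq))

Fibre-Theta-irrelevant : ∀ d t → Irrelevant (Fibre Theta d t)
Fibre-Theta-irrelevant d t (c , p) (c′ , p′) with odd-injective c c′ (trans (proj₁ p) (sym (proj₁ p′)))
... | refl = cong (c ,_) (≡×≡-irrelevant p p′)

odd-root : ∀ D t → D * D ≡ 8 * t + 1 → ∃[ m ] D ≡ suc (2 * m) × triangle m ≡ t
odd-root D t sq with even-or-odd D
... | inj₁ (m , refl) = ⊥-elim (even-square m t sq)
... | inj₂ (m , refl) =
  m , refl , *-cancelˡ-≡ (triangle m) t 8 (+-cancelʳ-≡ 1 _ _ (trans (sym (odd-square m)) sq))

Theta-root : ∀ d t → ∣ d ∣ * ∣ d ∣ ≡ 8 * t + 1 → Fibre Theta d t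
Theta-root (+ D) t sq with odd-root D t sq
... | m , refl , T≡t = + m , refl , T≡t
Theta-root -[1+ D ] t sq with odd-root (suc D) t sq
... | m , refl , T≡t = -[1+ m ] , refl , T≡t

Theta-square : ∀ d t → Fibre Theta d t ↔ (∣ d ∣ * ∣ d ∣ ≡ 8 * t + 1)
Theta-square d t = ↔-irrelevant square (Theta-root d t) (Fibre-Theta-irrelevant d t) uip
  where
  square : Fibre Theta d t → ∣ d ∣ * ∣ d ∣ ≡ 8 * t + 1
  square (+ m      , refl , refl) = odd-square m
  square (-[1+ m ] , refl , refl) = odd-square m

Fin-thetaCoeff : ∀ d t → Fin (thetaCoeff d t) ↔ Fibre Theta d t
Fin-thetaCoeff d t = Fin-if-≡ᵇ (∣ d ∣ * ∣ d ∣) (8 * t + 1) ⨾ ↔-sym (Theta-square d t)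

thetaCoeff-support : ∀ d t → Fin (thetaCoeff d t) → ∣ d ∣ ≤ 8 * t + 1
thetaCoeff-support d t x with ∣ d ∣ | to (Fin-if-≡ᵇ (∣ d ∣ * ∣ d ∣) (8 * t + 1)) x
... | zero  | _  = z≤n
... | suc D | sq = subst (suc D ≤_) sq (m≤m*n (suc D) (suc D))

Fin-if-≡ᵇ0↔Fibre-⊗^-zero : ∀ {X} n → Fin (if n ≡ᵇ 0 then 1 else 0) ↔ Fibre (X ⊗^ 0) (+ 0) n
Fin-if-≡ᵇ0↔Fibre-⊗^-zero n =
  Fin-if-≡ᵇ n 0 ⨾ ↔-irrelevant (refl ,_) proj₂ uip ≡×≡-irrelevant ⨾ ↔-sym Fibre-⊗^-zero

Fin-thetaPowCoeff : ∀ k e t → Fin (thetaPowCoeff k e t) ↔ Fibre (Theta ⊗^ k) e t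
Fin-thetaPowCoeff zero e t with e ℤ.≟ + 0
... | yes refl = Fin-if-≡ᵇ0↔Fibre-⊗^-zero t
... | no e≢0   = empty-↔ (λ ()) (λ (e≡0 , _) → e≢0 e≡0) ⨾ ↔-sym Fibre-⊗^-zero
Fin-thetaPowCoeff (suc k) e t =
  Fin-sumTo t _ ⨾
  Σ-×-↔ (λ t′ t′≤t → Fin-sumℤ (8 * t + 1) _ (support t′ t′≤t) ⨾
                      Σ-↔′ (λ d → Fin-* (Fin-thetaCoeff d t′) (Fin-thetaPowCoeff k (e ℤ.- d) (t ∸ t′)))) ⨾
  ↔-sym (Fibre-⊗ Theta (Theta ⊗^ k) e t) ⨾ ↔-sym Fibre-⊗^-suc
  where
  support : ∀ t′ → t′ ≤ t → ∀ d →
    Fin (thetaCoeff d t′ * thetaPowCoeff k (e ℤ.- d) (t ∸ t′)) → ∣ d ∣ ≤ 8 * t + 1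
  support t′ t′≤t d x = ≤-trans (thetaCoeff-support d t′ (proj₁ (to *↔× x))) (+-monoˡ-≤ 1 (*-monoʳ-≤ 8 t′≤t))

PartitionsOf : ℕ → Set
PartitionsOf = Fin ∘ invEulerCoeff

Partitions : Graded
Partitions = record { Carrier = Σ ℕ PartitionsOf ; charge = λ _ → + 0 ; weight = proj₁ }

Fin-invEulerCoeff : ∀ u → Fin (invEulerCoeff u) ↔ Fibre Partitions (+ 0) u
Fin-invEulerCoeff u = mk↔ₛ′ (λ x → (u , x) , refl , refl) (λ { ((_ , x) , _ , refl) → x })
  (λ { ((_ , x) , c , refl) → cong (λ c′ → (u , x) , c′ , refl) (uip _ _) }) (λ _ → refl)

Fin-invEulerPowCoeff : ∀ k u → Fin (invEulerPowCoeff k u) ↔ Fibre (Partitions ⊗^ k) (+ 0) u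
Fin-invEulerPowCoeff zero    u = Fin-if-≡ᵇ0↔Fibre-⊗^-zero u
Fin-invEulerPowCoeff (suc k) u =
  Fin-sumTo-uncharged u (+ 0) invEulerCoeff (invEulerPowCoeff k) (Σcharge-uncharged Partitions (λ _ → refl))
    Fin-invEulerCoeff (Fin-invEulerPowCoeff k) ⨾ ↔-sym Fibre-⊗^-suc

Fin-Fcoeff : ∀ k a2 n → Fin (Fcoeff k a2 n) ↔ Fibre ((Theta ⊗ Partitions) ⊗^ k) (+ a2) n
Fin-Fcoeff k a2 n =
  Fin-sumTo-uncharged n (+ a2) (thetaPowCoeff k (+ a2)) (invEulerPowCoeff k)
    (Σcharge-uncharged Partitions (λ _ → refl)) (Fin-thetaPowCoeff k (+ a2)) (Fin-invEulerPowCoeff k) ⨾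
  Fibre-zip Theta Partitions k (+ a2) n

sumTo-suc : ∀ q f → sumTo (suc q) f ≡ f 0 + sumTo q (f ∘ suc)
sumTo-suc q f = cong (λ xs → f 0 + sum xs)
  (trans (map-applyUpTo suc f (suc q)) (sym (map-applyUpTo id (f ∘ suc) (suc q))))

sumTo-cong : ∀ q {f g : ℕ → ℕ} → (∀ t → f t ≡ g t) → sumTo q f ≡ sumTo q g
sumTo-cong q f≗g = cong sum (map-cong f≗g (applyUpTo id (suc q)))

partsUpTo-suc-≥ : ∀ i w → suc i ≤ w → partsUpTo (suc i) w ≡ partsUpTo i w + partsUpTo (suc i) (w ∸ suc i)
partsUpTo-suc-≥ i w i<w = begin
  sumTo (w / suc i) (λ t → partsUpTo i (w ∸ t * suc i))
    ≡⟨ cong (λ q → sumTo q (λ t → partsUpTo i (w ∸ t * suc i))) (m/n≡1+[m∸n]/n i<w) ⟩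
  sumTo (suc q) (λ t → partsUpTo i (w ∸ t * suc i))
    ≡⟨ sumTo-suc q (λ t → partsUpTo i (w ∸ t * suc i)) ⟩
  partsUpTo i w + sumTo q (λ t → partsUpTo i (w ∸ (suc i + t * suc i)))
    ≡⟨ cong (λ x → partsUpTo i w + x) (sumTo-cong q remove-one) ⟩
  partsUpTo i w + partsUpTo (suc i) (w ∸ suc i)
    ∎
  where
  open ≡-Reasoning
  q : ℕ
  q = (w ∸ suc i) / suc i
  remove-one : ∀ t → partsUpTo i (w ∸ (suc i + t * suc i)) ≡ partsUpTo i ((w ∸ suc i) ∸ t * suc i)
  remove-one t = cong (partsUpTo i) (sym (∸-+-assoc w (suc i) (t * suc i)))

partsUpTo-suc-< : ∀ i w → w < suc i → partsUpTo (suc i) w ≡ partsUpTo i w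
partsUpTo-suc-< i w w<i = trans (cong (λ q → sumTo q (λ t → partsUpTo i (w ∸ t * suc i))) (m<n⇒m/n≡0 w<i))
  (+-identityʳ _)

-- A partition with parts at most i + 1 has no part i + 1, or is one with such a part removed.
Fin-partsUpTo-suc : ∀ i w →
  Fin (partsUpTo (suc i) w) ↔ (Fin (partsUpTo i w) ⊎ Shifted (suc i) (Fin ∘ partsUpTo (suc i)) w)
Fin-partsUpTo-suc i w with suc i ≤? w
... | yes i<w = subst-↔ Fin (partsUpTo-suc-≥ i w i<w) ⨾ +↔⊎ ⨾ ↔-refl ⊎-↔ Shifted-∸ i<w
... | no  i≮w = subst-↔ Fin (partsUpTo-suc-< i w (≰⇒> i≮w)) ⨾ ↔-sym (⊎-empty (Shifted-empty (≰⇒> i≮w)))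

partsUpTo-stable : ∀ I w → w ≤ I → partsUpTo I w ≡ invEulerCoeff w
partsUpTo-stable I w w≤I = subst (λ I → partsUpTo I w ≡ partsUpTo w w) (m∸n+n≡m w≤I) (above (I ∸ w))
  where
  above : ∀ d → partsUpTo (d + w) w ≡ partsUpTo w w
  above zero    = refl
  above (suc d) = trans (partsUpTo-suc-< (d + w) w (s≤s (m≤n+m w d))) (above d)

-- One colour: a window of top positions [0, I) and bottom positions [0, J)

infixl 7 _·_
_·_ : Bool → ℕ → ℕ
true  · x = x
false · x = 0

count : ∀ {L} → Vec Bool L → ℕ
count []      = 0
count (b ∷ v) = b · 1 + count v

-- The head of a vector of length L says whether L - 1 is a member; weightFrom s adds up s + p
-- over the members p.
weightFrom : ∀ {L} → ℕ → Vec Bool L → ℕ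
weightFrom         s []      = 0
weightFrom {suc L} s (b ∷ v) = b · (s + L) + weightFrom s v

windowCharge : ∀ {I J} → Vec Bool I × Vec Bool J → ℤ
windowCharge (A , B) = + count A ℤ.- + count B

-- A top entry a of an F-partition weighs a + 1, a bottom entry b weighs b.
windowWeight : ∀ {I J} → Vec Bool I × Vec Bool J → ℕ
windowWeight (A , B) = weightFrom 1 A + weightFrom 0 B

Window : ℕ → ℕ → Graded
Window I J = record { Carrier = Vec Bool I × Vec Bool J ; charge = windowCharge ; weight = windowWeight }

·-suc : ∀ b x → b · suc x ≡ b · x + b · 1
·-suc true  x = +-comm 1 x
·-suc false x = refl

weightFrom-suc : ∀ {L} s (v : Vec Bool L) → weightFrom (suc s) v ≡ weightFrom s v + count v
weightFrom-suc         s []      = refl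
weightFrom-suc {suc L} s (b ∷ v) = begin
  b · suc (s + L) + weightFrom (suc s) v
    ≡⟨ cong₂ _+_ (·-suc b (s + L)) (weightFrom-suc s v) ⟩
  (b · (s + L) + b · 1) + (weightFrom s v + count v)
    ≡⟨ +-interchange (b · (s + L)) (b · 1) (weightFrom s v) (count v) ⟩
  (b · (s + L) + weightFrom s v) + (b · 1 + count v) ∎
  where open ≡-Reasoning

count-∷ʳ : ∀ {L} (v : Vec Bool L) b → count (v ∷ʳ b) ≡ count v + b · 1
count-∷ʳ []      b = +-identityʳ (b · 1)
count-∷ʳ (c ∷ v) b =
  trans (cong (λ n → c · 1 + n) (count-∷ʳ v b)) (sym (+-assoc (c · 1) (count v) (b · 1)))

weightFrom-∷ʳ : ∀ {L} s (v : Vec Bool L) b → weightFrom s (v ∷ʳ b) ≡ weightFrom (suc s) v + b · s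
weightFrom-∷ʳ         s []      b = trans (+-identityʳ (b · (s + 0))) (cong (b ·_) (+-identityʳ s))
weightFrom-∷ʳ {suc L} s (c ∷ v) b = begin
  c · (s + suc L) + weightFrom s (v ∷ʳ b)
    ≡⟨ cong₂ _+_ (cong (c ·_) (+-suc s L)) (weightFrom-∷ʳ s v b) ⟩
  c · suc (s + L) + (weightFrom (suc s) v + b · s)
    ≡⟨ +-assoc (c · suc (s + L)) (weightFrom (suc s) v) (b · s) ⟨
  c · suc (s + L) + weightFrom (suc s) v + b · s ∎
  where open ≡-Reasoning

-- Translating the Maya diagram by one site: position 0 of the top row becomes position 0 of the
-- bottom row, with membership toggled because the bottom row records holes.
shift : ∀ {I J} → Carrier (Window (suc I) J) → Carrier (Window I (suc J))
shift (A , B) = init A , B ∷ʳ not (last A)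

unshift : ∀ {I J} → Carrier (Window I (suc J)) → Carrier (Window (suc I) J)
unshift (A , B) = A ∷ʳ not (last B) , init B

init-∷ʳ-last : ∀ {L} (v : Vec A (suc L)) → init v ∷ʳ last v ≡ v
init-∷ʳ-last v = sym (proj₂ (proj₂ (initLast v)))

shift-↔ : ∀ {I J} → Carrier (Window (suc I) J) ↔ Carrier (Window I (suc J))
shift-↔ = mk↔ₛ′ shift unshift
  (λ (A , B) → cong₂ _,_ (init-∷ʳ _ A) (∷ʳ-not-last B A))
  (λ (A , B) → cong₂ _,_ (∷ʳ-not-last A B) (init-∷ʳ _ B))
  where
  ∷ʳ-not-last : ∀ {L M} (v : Vec Bool (suc L)) (u : Vec Bool M) →
    init v ∷ʳ not (last (u ∷ʳ not (last v))) ≡ v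
  ∷ʳ-not-last v u = begin
    init v ∷ʳ not (last (u ∷ʳ not (last v)))   ≡⟨ cong (λ b → init v ∷ʳ not b) (last-∷ʳ _ u) ⟩
    init v ∷ʳ not (not (last v))               ≡⟨ cong (init v ∷ʳ_) (not-involutive (last v)) ⟩
    init v ∷ʳ last v                           ≡⟨ init-∷ʳ-last v ⟩
    v                                          ∎
    where open ≡-Reasoning

ShiftGrades : ∀ {I J} → Carrier (Window (suc I) J) → Set
ShiftGrades x =
  (+ 1 ℤ.+ windowCharge (shift x) ≡ windowCharge x) ×
  (windowCharge x ℤ.+ + windowWeight (shift x) ≡ + windowWeight x)

shift-grades-∷ʳ : ∀ {I J} (A : Vec Bool I) b (B : Vec Bool J) → ShiftGrades (A ∷ʳ b , B)
shift-grades-∷ʳ A b B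
  rewrite init-∷ʳ b A | last-∷ʳ b A | count-∷ʳ A b | count-∷ʳ B (not b)
        | weightFrom-∷ʳ 1 A b | weightFrom-∷ʳ 0 B (not b) | weightFrom-suc 1 A | weightFrom-suc 0 B
  with b
... | true  = charge-true (+ count A) (+ count B) ,
              weight-true (+ count A) (+ count B) (+ weightFrom 1 A) (+ weightFrom 0 B)
  where
  charge-true : ∀ a c → + 1 ℤ.+ (a ℤ.- (c ℤ.+ + 0)) ≡ (a ℤ.+ + 1) ℤ.- c
  charge-true = solve-∀
  weight-true : ∀ a c p q → ((a ℤ.+ + 1) ℤ.- c) ℤ.+ (p ℤ.+ ((q ℤ.+ c) ℤ.+ + 0)) ≡ ((p ℤ.+ a) ℤ.+ + 1) ℤ.+ q
  weight-true = solve-∀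
... | false = charge-false (+ count A) (+ count B) ,
              weight-false (+ count A) (+ count B) (+ weightFrom 1 A) (+ weightFrom 0 B)
  where
  charge-false : ∀ a c → + 1 ℤ.+ (a ℤ.- (c ℤ.+ + 1)) ≡ (a ℤ.+ + 0) ℤ.- c
  charge-false = solve-∀
  weight-false : ∀ a c p q → ((a ℤ.+ + 0) ℤ.- c) ℤ.+ (p ℤ.+ ((q ℤ.+ c) ℤ.+ + 0)) ≡ ((p ℤ.+ a) ℤ.+ + 0) ℤ.+ q
  weight-false = solve-∀

shift-grades : ∀ {I J} (x : Carrier (Window (suc I) J)) → ShiftGrades x
shift-grades (A , B) =
  subst (λ A → ShiftGrades (A , B)) (init-∷ʳ-last A) (shift-grades-∷ʳ (init A) (last A) B)

Window-shift : ∀ {I J} c v →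
  Σ (Carrier (Window (suc I) J)) (λ x → windowCharge x ≡ + 1 ℤ.+ c × + windowWeight x ≡ v) ↔
  Σ (Carrier (Window I (suc J))) (λ y → windowCharge y ≡ c × (+ 1 ℤ.+ c) ℤ.+ + windowWeight y ≡ v)
Window-shift {I} {J} c v = Σ-↔-irrelevant shift-↔ forth back (λ _ → ≡×≡-irrelevant) (λ _ → ≡×≡-irrelevant)
  where
  open ≡-Reasoning
  Before : Carrier (Window (suc I) J) → Set
  Before x = windowCharge x ≡ + 1 ℤ.+ c × + windowWeight x ≡ v
  After : Carrier (Window I (suc J)) → Set
  After y = windowCharge y ≡ c × (+ 1 ℤ.+ c) ℤ.+ + windowWeight y ≡ v
  forth : ∀ x → Before x → After (shift x)
  forth x (ch , wt) = ℤ+-cancelˡ (+ 1) _ _ (trans (proj₁ (shift-grades x)) ch) ,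
    trans (cong (λ z → z ℤ.+ + windowWeight (shift x)) (sym ch)) (trans (proj₂ (shift-grades x)) wt)
  back : ∀ y → After y → Before (unshift y)
  back y (ch , wt) = charge-unshift , (begin
    + windowWeight (unshift y)
      ≡⟨ proj₂ (shift-grades (unshift y)) ⟨
    windowCharge (unshift y) ℤ.+ + windowWeight (shift (unshift y))
      ≡⟨ cong₂ (λ a b → a ℤ.+ + windowWeight b) charge-unshift (strictlyInverseˡ shift-↔ y) ⟩
    (+ 1 ℤ.+ c) ℤ.+ + windowWeight y
      ≡⟨ wt ⟩
    v ∎)
    where
    charge-unshift : windowCharge (unshift y) ≡ + 1 ℤ.+ c
    charge-unshift = begin
      windowCharge (unshift y)
        ≡⟨ proj₁ (shift-grades (unshift y)) ⟨
      + 1 ℤ.+ windowCharge (shift (unshift y))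
        ≡⟨ cong (λ y → + 1 ℤ.+ windowCharge y) (strictlyInverseˡ shift-↔ y) ⟩
      + 1 ℤ.+ windowCharge y
        ≡⟨ cong (λ z → + 1 ℤ.+ z) ch ⟩
      + 1 ℤ.+ c ∎

+-≡-↔ : ∀ {m n} → (m ≡ n) ↔ (+ m ≡ + n)
+-≡-↔ = ↔-irrelevant (cong (λ n → + n)) ℤ.+-injective uip uip

Window-shift-+ : ∀ {I J} m w →
  Fibre (Window (suc I) J) (+ suc m) w ↔ Shifted (suc m) (Fibre (Window I (suc J)) (+ m)) w
Window-shift-+ m w = Σ-↔′ (λ _ → ↔-refl ×-↔ +-≡-↔) ⨾ Window-shift (+ m) (+ w) ⨾
  Σ-↔′ (λ _ → ↔-refl ×-↔ ↔-sym +-≡-↔) ⨾ Fibre-Shifted (suc m) w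

Window-shift-- : ∀ {I J} m w →
  Fibre (Window I (suc J)) -[1+ m ] w ↔ Shifted m (Fibre (Window (suc I) J) (+ 1 ℤ.+ -[1+ m ])) w
Window-shift-- m w = Σ-↔′ (λ _ → ↔-refl ×-↔ cancel-↔) ⨾ ↔-sym (Window-shift -[1+ m ] _) ⨾
  Σ-↔′ (λ _ → ↔-refl ×-↔ recentre-↔) ⨾ Fibre-Shifted m w
  where
  cancel-↔ : ∀ {a} → (a ≡ w) ↔ ((+ 1 ℤ.+ -[1+ m ]) ℤ.+ + a ≡ (+ 1 ℤ.+ -[1+ m ]) ℤ.+ + w)
  cancel-↔ = ↔-irrelevant (cong (λ a → (+ 1 ℤ.+ -[1+ m ]) ℤ.+ + a))
    (ℤ.+-injective ∘ ℤ+-cancelˡ (+ 1 ℤ.+ -[1+ m ]) _ _) uip uip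
  -- -[1+ m ] computes to ℤ.- (+ 1 ℤ.+ + m), the form the solver understands.
  recentre : ∀ m a → a ≡ (+ 1 ℤ.+ ℤ.- (+ 1 ℤ.+ m)) ℤ.+ (m ℤ.+ a)
  recentre = solve-∀
  uncentre : ∀ m b → m ℤ.+ ((+ 1 ℤ.+ ℤ.- (+ 1 ℤ.+ m)) ℤ.+ b) ≡ b
  uncentre = solve-∀
  recentre-↔ : ∀ {a} → (+ a ≡ (+ 1 ℤ.+ -[1+ m ]) ℤ.+ + w) ↔ (m + a ≡ w)
  recentre-↔ {a} = ↔-irrelevant
    (λ eq → ℤ.+-injective (trans (cong (λ z → + m ℤ.+ z) eq) (uncentre (+ m) (+ w))))
    (λ { refl → recentre (+ m) (+ a) }) uip uip

-- Is the largest top position i occupied?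
Window-top-split : ∀ {i J} c w → Fibre (Window (suc i) J) (+ 1 ℤ.+ c) w ↔
  (Fibre (Window i J) (+ 1 ℤ.+ c) w ⊎ Shifted (suc i) (Fibre (Window i J) c) w)
Window-top-split {i} {J} c w = mk↔ₛ′ split join
  (λ { (inj₁ _) → refl
     ; (inj₂ (_ , e , x , ch , refl)) → cong₂ (λ e ch → inj₂ (_ , e , x , ch , refl)) (uip _ _) (uip _ _) })
  (λ { ((false ∷ A , B) , _) → refl
     ; ((true ∷ A , B) , cw) → cong (λ cw → (true ∷ A , B) , cw) (≡×≡-irrelevant _ cw) })
  where
  Split : Set
  Split = Fibre (Window i J) (+ 1 ℤ.+ c) w ⊎ Shifted (suc i) (Fibre (Window i J) c) w
  occupied : ∀ a b → + 1 ℤ.+ (a ℤ.- b) ≡ (+ 1 ℤ.+ a) ℤ.- b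
  occupied = solve-∀
  split : Fibre (Window (suc i) J) (+ 1 ℤ.+ c) w → Split
  split ((false ∷ A , B) , ch , wt) = inj₁ ((A , B) , ch , wt)
  split ((true  ∷ A , B) , ch , wt) =
    inj₂ (_ , trans (sym (+-assoc (suc i) (weightFrom 1 A) (weightFrom 0 B))) wt ,
          (A , B) , ℤ+-cancelˡ (+ 1) _ _ (trans (occupied (+ count A) (+ count B)) ch) , refl)
  join : Split → Fibre (Window (suc i) J) (+ 1 ℤ.+ c) w
  join (inj₁ ((A , B) , ch , wt)) = (false ∷ A , B) , ch , wt
  join (inj₂ (_ , e , (A , B) , ch , refl)) = (true ∷ A , B) ,
    trans (sym (occupied (+ count A) (+ count B))) (cong (λ z → + 1 ℤ.+ z) ch) ,
    trans (+-assoc (suc i) (weightFrom 1 A) (weightFrom 0 B)) e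

count≡0 : ∀ {L} (v : Vec Bool L) → count v ≡ 0 → v ≡ replicate L false
count≡0 []          _  = refl
count≡0 (false ∷ v) eq = cong (false ∷_) (count≡0 v eq)

count-replicate : ∀ L → count (replicate L false) ≡ 0
count-replicate zero    = refl
count-replicate (suc L) = count-replicate L

weightFrom-replicate : ∀ L s → weightFrom s (replicate L false) ≡ 0
weightFrom-replicate zero    s = refl
weightFrom-replicate (suc L) s = weightFrom-replicate L s

-- Without top positions, charge 0 forces an empty bottom row.
Window-charge-zero-base : ∀ J w → Fibre (Window 0 J) (+ 0) w ↔ Fin (partsUpTo 0 w)
Window-charge-zero-base J w = ↔-irrelevant weight≡0 (λ { refl → empty }) unique uip ⨾ ↔-sym (Fin-if-≡ᵇ w 0)
  where
  bottom-empty : ∀ (B : Vec Bool J) → + 0 ℤ.- + count B ≡ + 0 → B ≡ replicate J false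
  bottom-empty B ch = count≡0 B (ℤ.+-injective (begin
    + count B                  ≡⟨ ℤ.neg-involutive _ ⟨
    ℤ.- (ℤ.- + count B)        ≡⟨ cong ℤ.-_ (ℤ.+-identityˡ _) ⟨
    ℤ.- (+ 0 ℤ.- + count B)    ≡⟨ cong ℤ.-_ ch ⟩
    + 0                        ∎))
    where open ≡-Reasoning
  empty : Fibre (Window 0 J) (+ 0) 0
  empty = ([] , replicate J false) , cong (λ n → + 0 ℤ.- + n) (count-replicate J) ,
          weightFrom-replicate J 0
  weight≡0 : Fibre (Window 0 J) (+ 0) w → w ≡ 0
  weight≡0 (([] , B) , ch , wt) rewrite bottom-empty B ch = trans (sym wt) (weightFrom-replicate J 0)
  unique : Irrelevant (Fibre (Window 0 J) (+ 0) w)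
  unique (([] , B) , p) (([] , B′) , p′) with bottom-empty B (proj₁ p) | bottom-empty B′ (proj₁ p′)
  ... | refl | refl = cong (([] , replicate J false) ,_) (≡×≡-irrelevant p p′)

-- This mirrors Fin-partsUpTo-suc: an occupied top position i is removed and the window shifted back
-- to charge 0. The bound w ≤ J keeps the bottom row from being truncated.
mutual
  Window-charge-zero : ∀ i J w → w ≤ J → Fibre (Window i J) (+ 0) w ↔ Fin (partsUpTo i w)
  Window-charge-zero zero    J w _   = Window-charge-zero-base J w
  Window-charge-zero (suc i) J w w≤J =
    Window-top-split -[1+ 0 ] w ⨾
    Window-charge-zero i J w w≤J ⊎-↔
      Shifted-↔ (suc i) (λ w′ e → Window-charge-minus-one i J w′ (≤-trans (shifted-< e) w≤J)) ⨾
    ↔-sym (Fin-partsUpTo-suc i w)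

  Window-charge-minus-one : ∀ i J w → suc w ≤ J → Fibre (Window i J) -[1+ 0 ] w ↔ Fin (partsUpTo (suc i) w)
  Window-charge-minus-one i (suc J) w (s≤s w≤J) =
    Window-shift-- 0 w ⨾ Shifted-zero ⨾ Window-charge-zero (suc i) J w w≤J

-- Repeated shifting brings a window of charge c to charge 0, lowering the weight by c(c+1)/2.
Window-Jacobi-+ : ∀ m I J w → w ≤ I → w ≤ J →
  Fibre (Window I J) (+ m) w ↔ Shifted (triangle m) PartitionsOf w
Window-Jacobi-+ zero I J w w≤I w≤J =
  Window-charge-zero I J w w≤J ⨾ subst-↔ Fin (partsUpTo-stable I w w≤I) ⨾ ↔-sym Shifted-zero
Window-Jacobi-+ (suc m) zero J w w≤0 _ = empty-↔ no-top-row (Shifted-empty (s≤s (≤-trans w≤0 z≤n)))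
  where
  no-top-row : ¬ Fibre (Window 0 J) (+ suc m) w
  no-top-row (([] , B) , ch , _) with count B
  no-top-row (([] , B) , () , _) | zero
  no-top-row (([] , B) , () , _) | suc _
Window-Jacobi-+ (suc m) (suc I) J w w≤I w≤J =
  Window-shift-+ m w ⨾
  Shifted-↔ (suc m) (λ w′ e → Window-Jacobi-+ m I (suc J) w′ (≤-pred (≤-trans (shifted-< e) w≤I))
                                                          (m≤n⇒m≤1+n (≤-trans (shifted-≤ e) w≤J))) ⨾
  Shifted-+ (suc m) (triangle m)

Window-Jacobi-- : ∀ m I J w → w ≤ I → w < J →
  Fibre (Window I J) -[1+ m ] w ↔ Shifted (triangle m) PartitionsOf w
Window-Jacobi-- zero I (suc J) w w≤I (s≤s w≤J) =
  Window-shift-- 0 w ⨾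
  Shifted-↔ 0 (λ { w′ refl → Window-Jacobi-+ 0 (suc I) J w′ (m≤n⇒m≤1+n w≤I) w≤J }) ⨾
  Shifted-+ 0 0
Window-Jacobi-- (suc m) I (suc J) w w≤I (s≤s w≤J) =
  Window-shift-- (suc m) w ⨾
  Shifted-↔ (suc m) (λ w′ e → Window-Jacobi-- m (suc I) J w′ (m≤n⇒m≤1+n (≤-trans (shifted-≤ e) w≤I))
                                                           (≤-trans (shifted-< e) w≤J)) ⨾
  Shifted-+ (suc m) (triangle m)

Window-Jacobi : ∀ N c w → w < N → Fibre (Window N N) c w ↔ Shifted (triangleℤ c) PartitionsOf w
Window-Jacobi N (+ m)    w w<N = Window-Jacobi-+ m N N w (<⇒≤ w<N) (<⇒≤ w<N)
Window-Jacobi N -[1+ m ] w w<N = Window-Jacobi-- m N N w (<⇒≤ w<N) w<N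

Doubled : Graded → Graded
Doubled X = record { Carrier = Carrier X ; charge = odd ∘ charge X ; weight = weight X }

Fibre-Doubled : ∀ X e w → Fibre (Doubled X) e w ↔ Σ ℤ (λ c → odd c ≡ e × Fibre X c w)
Fibre-Doubled X e w = mk↔ₛ′ (λ { (x , ch , wt) → charge X x , ch , x , refl , wt })
  (λ { (_ , ch , x , refl , wt) → x , ch , wt })
  (λ { (_ , ch , x , refl , wt) → refl }) (λ { (x , ch , wt) → refl })

Fibre-Theta⊗Partitions : ∀ e w →
  Fibre (Theta ⊗ Partitions) e w ↔ Σ ℤ (λ c → odd c ≡ e × Shifted (triangleℤ c) PartitionsOf w)
Fibre-Theta⊗Partitions e w = mk↔ₛ′
  (λ { ((c , u , x) , ch , wt) → c , trans (sym (ℤ.+-identityʳ (odd c))) ch , u , wt , x })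
  (λ { (c , ch , u , wt , x) → (c , u , x) , trans (ℤ.+-identityʳ (odd c)) ch , wt })
  (λ { (c , ch , u , wt , x) → cong (λ ch → c , ch , u , wt , x) (uip _ _) })
  (λ { ((c , u , x) , ch , wt) → cong (λ ch → (c , u , x) , ch , wt) (uip _ _) })

Colour-Jacobi : ∀ N e w → w < N → Fibre (Doubled (Window N N)) e w ↔ Fibre (Theta ⊗ Partitions) e w
Colour-Jacobi N e w w<N = Fibre-Doubled (Window N N) e w ⨾
  Σ-↔′ (λ c → ↔-refl ×-↔ Window-Jacobi N c w w<N) ⨾ ↔-sym (Fibre-Theta⊗Partitions e w)

-- Colours are compared as numbers, so that the bound J may be k, above every colour.
Below : ℕ → ℕ → ℕ → ℕ → Set
Below m c M J = m < M ⊎ (m ≡ M × c < J)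

Below-irrelevant : ∀ {m c M J} → Irrelevant (Below m c M J)
Below-irrelevant (inj₁ p)       (inj₁ q)        = cong inj₁ (<-irrelevant p q)
Below-irrelevant (inj₁ p)       (inj₂ (refl , _)) = ⊥-elim (<-irrefl refl p)
Below-irrelevant (inj₂ (refl , _)) (inj₁ q)       = ⊥-elim (<-irrefl refl q)
Below-irrelevant (inj₂ (e , p)) (inj₂ (e′ , q)) = cong₂ (λ e p → inj₂ (e , p)) (uip e e′) (<-irrelevant p q)

HeadBelow : ∀ {k} → ℕ → ℕ → List (ColInt k) → Set
HeadBelow M J []            = ⊤
HeadBelow M J ((m , j) ∷ _) = Below m (toℕ j) M J

HeadBelow-irrelevant : ∀ {k M J} (xs : List (ColInt k)) → Irrelevant (HeadBelow M J xs)
HeadBelow-irrelevant []      tt tt = refl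
HeadBelow-irrelevant (_ ∷ _) p  q  = Below-irrelevant p q

StrictDec-irrelevant : ∀ {k} (xs : List (ColInt k)) → Irrelevant (StrictDec xs)
StrictDec-irrelevant []          []       []         = refl
StrictDec-irrelevant (x ∷ [])    [-]      [-]        = refl
StrictDec-irrelevant (x ∷ y ∷ xs) (r ∷ rs) (r′ ∷ rs′) =
  cong₂ _∷_ (Below-irrelevant r r′) (StrictDec-irrelevant (y ∷ xs) rs rs′)

BoundedRow : ℕ → ℕ → ℕ → Set
BoundedRow k M J = Σ (List (ColInt k)) (λ xs → StrictDec xs × HeadBelow M J xs)

-- The same rows with the order built in; the colour is repeated as the number c so that the bound
-- of the tail stays a pattern.
data SortedRow (k : ℕ) : ℕ → ℕ → Set where
  []   : ∀ {M J} → SortedRow k M J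
  cons : ∀ {M J} m (j : Fin k) c → toℕ j ≡ c → Below m c M J → SortedRow k m c → SortedRow k M J

size : ∀ {k M J} → SortedRow k M J → ℕ
size []                 = 0
size (cons _ _ _ _ _ d) = suc (size d)

total : ∀ {k M J} → SortedRow k M J → ℕ
total []                 = 0
total (cons m _ _ _ _ d) = m + total d

toSorted : ∀ {k} M J (xs : List (ColInt k)) → StrictDec xs → HeadBelow M J xs → SortedRow k M J
toSorted M J []                  _        _ = []
toSorted M J ((m , j) ∷ [])      _        h = cons m j (toℕ j) refl h []
toSorted M J ((m , j) ∷ y ∷ xs)  (r ∷ rs) h = cons m j (toℕ j) refl h (toSorted m (toℕ j) (y ∷ xs) rs r)

consBounded : ∀ {k} (x : ColInt k) (ys : List (ColInt k)) → StrictDec ys →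
  HeadBelow (proj₁ x) (toℕ (proj₂ x)) ys → StrictDec (x ∷ ys)
consBounded x []      _  _ = [-]
consBounded x (y ∷ _) rs r = r ∷ rs

fromSorted : ∀ {k M J} → SortedRow k M J → BoundedRow k M J
fromSorted []                       = [] , [] , tt
fromSorted (cons m j _ refl h d) with fromSorted d
... | ys , rs , r = (m , j) ∷ ys , consBounded (m , j) ys rs r , h

BoundedRow-≡ : ∀ {k M J} {a b : BoundedRow k M J} → proj₁ a ≡ proj₁ b → a ≡ b
BoundedRow-≡ {a = xs , p} {.xs , q} refl =
  cong (xs ,_) (cong₂ _,_ (StrictDec-irrelevant xs (proj₁ p) (proj₁ q))
                          (HeadBelow-irrelevant xs (proj₂ p) (proj₂ q)))

fromSorted-toSorted : ∀ {k} M J (xs : List (ColInt k)) rs h → proj₁ (fromSorted (toSorted M J xs rs h)) ≡ xs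
fromSorted-toSorted M J []                 _        _ = refl
fromSorted-toSorted M J ((m , j) ∷ [])     _        _ = refl
fromSorted-toSorted M J ((m , j) ∷ y ∷ xs) (r ∷ rs) _ =
  cong ((m , j) ∷_) (fromSorted-toSorted m (toℕ j) (y ∷ xs) rs r)

toSorted-fromSorted : ∀ {k M J} (d : SortedRow k M J) →
  let (xs , rs , h) = fromSorted d in toSorted M J xs rs h ≡ d
toSorted-fromSorted []                    = refl
toSorted-fromSorted (cons m j _ refl h d) with fromSorted d | toSorted-fromSorted d
... | []    , _ , _ | refl = refl
... | _ ∷ _ , _ , _ | refl = refl

BoundedRow↔SortedRow : ∀ {k} M J → BoundedRow k M J ↔ SortedRow k M J
BoundedRow↔SortedRow M J = mk↔ₛ′ (λ (xs , rs , h) → toSorted M J xs rs h) fromSorted toSorted-fromSorted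
  (λ (xs , rs , h) → BoundedRow-≡ (fromSorted-toSorted M J xs rs h))

size-toSorted : ∀ {k} M J (xs : List (ColInt k)) rs h → size (toSorted M J xs rs h) ≡ length xs
size-toSorted M J []                 _        _ = refl
size-toSorted M J ((m , j) ∷ [])     _        _ = refl
size-toSorted M J ((m , j) ∷ y ∷ xs) (r ∷ rs) _ = cong suc (size-toSorted m (toℕ j) (y ∷ xs) rs r)

total-toSorted : ∀ {k} M J (xs : List (ColInt k)) rs h → total (toSorted M J xs rs h) ≡ rowSum xs
total-toSorted M J []                 _        _ = refl
total-toSorted M J ((m , j) ∷ [])     _        _ = refl
total-toSorted M J ((m , j) ∷ y ∷ xs) (r ∷ rs) _ = cong (λ t → m + t) (total-toSorted m (toℕ j) (y ∷ xs) rs r)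

cons-≡ : ∀ {k M J m c} {j j′ : Fin k} {e e′ below below′} (d : SortedRow k m c) → j ≡ j′ →
  cons {M = M} {J = J} m j c e below d ≡ cons m j′ c e′ below′ d
cons-≡ {m = m} {c} {j} d refl = cong₂ (λ e below → cons m j c e below d) (uip _ _) (Below-irrelevant _ _)

BoundChange : ℕ → ℕ → ℕ → ℕ → ℕ → Set
BoundChange k M J M′ J′ = ∀ {m c} → c < k → Below m c M J → Below m c M′ J′

rebound : ∀ {k M J M′ J′} → BoundChange k M J M′ J′ → SortedRow k M J → SortedRow k M′ J′
rebound f []                     = []
rebound f (cons m j c e below d) = cons m j c e (f (subst (_< _) e (toℕ<n j)) below) d

rebound-rebound : ∀ {k M J M′ J′} (f : BoundChange k M′ J′ M J) (g : BoundChange k M J M′ J′) d →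
  rebound f (rebound g d) ≡ d
rebound-rebound f g []                     = refl
rebound-rebound f g (cons m j c e below d) = cong (λ below → cons m j c e below d) (Below-irrelevant _ _)

rebound-↔ : ∀ {k M J M′ J′} → BoundChange k M J M′ J′ → BoundChange k M′ J′ M J →
  SortedRow k M J ↔ SortedRow k M′ J′
rebound-↔ f g = mk↔ₛ′ (rebound f) (rebound g) (rebound-rebound f g) (rebound-rebound g f)

size-rebound : ∀ {k M J M′ J′} (f : BoundChange k M J M′ J′) d → size (rebound f d) ≡ size d
size-rebound f []                 = refl
size-rebound f (cons _ _ _ _ _ _) = refl

total-rebound : ∀ {k M J M′ J′} (f : BoundChange k M J M′ J′) d → total (rebound f d) ≡ total d
total-rebound f []                 = refl
total-rebound f (cons _ _ _ _ _ _) = refl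

-- Below (m + 1, colour 0) means below (m, colour k).
SortedRow-lower : ∀ {k} m → SortedRow k (suc m) 0 ↔ SortedRow k m k
SortedRow-lower {k} m = rebound-↔ lower raise
  where
  lower : BoundChange k (suc m) 0 m k
  lower c<k (inj₁ m′<1+m) with m≤n⇒m<n∨m≡n (≤-pred m′<1+m)
  ... | inj₁ m′<m = inj₁ m′<m
  ... | inj₂ m′≡m = inj₂ (m′≡m , c<k)
  raise : BoundChange k m k (suc m) 0
  raise _ (inj₁ m′<m)      = inj₁ (m<n⇒m<1+n m′<m)
  raise _ (inj₂ (refl , _)) = inj₁ (n<1+n m)

-- Splitting off the entry (m, colour J), if present.
SortedRow-colour : ∀ {k} m J → J < k → SortedRow k m (suc J) ↔ (Bool × SortedRow k m J)
SortedRow-colour {k} m J J<k = mk↔ₛ′ split join split-join join-split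
  where
  widen : BoundChange k m J m (suc J)
  widen _ (inj₁ m′<m)      = inj₁ m′<m
  widen _ (inj₂ (e , c<J)) = inj₂ (e , m<n⇒m<1+n c<J)
  join : Bool × SortedRow k m J → SortedRow k m (suc J)
  join (false , d) = rebound widen d
  join (true  , d) = cons m (fromℕ< J<k) J (toℕ-fromℕ< J<k) (inj₂ (refl , ≤-refl)) d
  split : SortedRow k m (suc J) → Bool × SortedRow k m J
  split []                                    = false , []
  split (cons m′ j c e (inj₁ m′<m) d)         = false , cons m′ j c e (inj₁ m′<m) d
  split (cons .m j c e (inj₂ (refl , c<1+J)) d) with c ≟ J
  ... | yes refl = true , d
  ... | no  c≢J  = false , cons m j c e (inj₂ (refl , ≤∧≢⇒< (≤-pred c<1+J) c≢J)) d
  split-join : ∀ y → split (join y) ≡ y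
  split-join (false , [])                                = refl
  split-join (false , cons m′ j c e (inj₁ m′<m) d)       = refl
  split-join (false , cons .m j c e (inj₂ (refl , c<J)) d) with c ≟ J
  ... | yes refl = ⊥-elim (<-irrefl refl c<J)
  ... | no  _    = cong (λ below → false , cons m j c e below d) (Below-irrelevant _ _)
  split-join (true , d) with J ≟ J
  ... | yes refl = refl
  ... | no  J≢J  = ⊥-elim (J≢J refl)
  join-split : ∀ x → join (split x) ≡ x
  join-split []                                    = refl
  join-split (cons m′ j c e (inj₁ _) d)            = refl
  join-split (cons .m j c e (inj₂ (refl , _)) d) with c ≟ J
  ... | yes refl = cons-≡ d (toℕ-injective (trans (toℕ-fromℕ< J<k) (sym e)))
  ... | no  _    = cong (λ below → cons m j c e below d) (Below-irrelevant _ _)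

size-colour : ∀ {k} m J J<k b (d : SortedRow k m J) →
  size (from (SortedRow-colour m J J<k) (b , d)) ≡ b · 1 + size d
size-colour m J J<k false d = size-rebound _ d
size-colour m J J<k true  d = refl

total-colour : ∀ {k} m J J<k b (d : SortedRow k m J) →
  total (from (SortedRow-colour m J J<k) (b , d)) ≡ b · m + total d
total-colour m J J<k false d = total-rebound _ d
total-colour m J J<k true  d = refl

-- The entries of value m, listed by colour from k - 1 down to 0.
SortedRow-layer : ∀ {k} m J → J ≤ k → SortedRow k m J ↔ (Vec Bool J × SortedRow k m 0)
SortedRow-layer m zero    _   = mk↔ₛ′ ([] ,_) proj₂ (λ { ([] , d) → refl }) (λ _ → refl)
SortedRow-layer m (suc J) J<k =
  SortedRow-colour m J J<k ⨾ ↔-refl ×-↔ SortedRow-layer m J (<⇒≤ J<k) ⨾ ↔-sym Σ-assoc ⨾ ∷-↔ ×-↔ ↔-refl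

size-layer : ∀ {k} m J J≤k v (d : SortedRow k m 0) →
  size (from (SortedRow-layer m J J≤k) (v , d)) ≡ count v + size d
size-layer m zero    _   []      d = refl
size-layer m (suc J) J<k (b ∷ v) d = begin
  size (from (SortedRow-colour m J J<k) (b , from (SortedRow-layer m J _) (v , d)))
    ≡⟨ size-colour m J J<k b _ ⟩
  b · 1 + size (from (SortedRow-layer m J _) (v , d))
    ≡⟨ cong (λ s → b · 1 + s) (size-layer m J _ v d) ⟩
  b · 1 + (count v + size d)
    ≡⟨ +-assoc (b · 1) (count v) (size d) ⟨
  b · 1 + count v + size d ∎
  where open ≡-Reasoning

·-as-* : ∀ b m → b · m ≡ m * (b · 1)
·-as-* true  m = sym (*-identityʳ m)
·-as-* false m = sym (*-zeroʳ m)

total-layer : ∀ {k} m J J≤k v (d : SortedRow k m 0) →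
  total (from (SortedRow-layer m J J≤k) (v , d)) ≡ m * count v + total d
total-layer m zero    _   []      d = cong (_+ total d) (sym (*-zeroʳ m))
total-layer m (suc J) J<k (b ∷ v) d = begin
  total (from (SortedRow-colour m J J<k) (b , from (SortedRow-layer m J _) (v , d)))
    ≡⟨ total-colour m J J<k b _ ⟩
  b · m + total (from (SortedRow-layer m J _) (v , d))
    ≡⟨ cong₂ _+_ (·-as-* b m) (total-layer m J _ v d) ⟩
  m * (b · 1) + (m * count v + total d)
    ≡⟨ +-assoc (m * (b · 1)) (m * count v) (total d) ⟨
  m * (b · 1) + m * count v + total d
    ≡⟨ cong (_+ total d) (*-distribˡ-+ m (b · 1) (count v)) ⟨
  m * (b · 1 + count v) + total d ∎
  where open ≡-Reasoning

uncons-columns : ∀ {m k} → Vec (Vec A (suc m)) k ↔ (Vec A k × Vec (Vec A m) k)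
uncons-columns = mk↔ₛ′ (λ V → Vec.map head V , Vec.map tail V) (λ (l , M) → zipWith _∷_ l M)
  (λ (l , M) → cong₂ _,_ (map-head-zip l M) (map-tail-zip l M)) zip-map-head-tail
  where
  map-head-zip : ∀ {m k} (l : Vec A k) (M : Vec (Vec A m) k) → Vec.map head (zipWith _∷_ l M) ≡ l
  map-head-zip []      []      = refl
  map-head-zip (x ∷ l) (_ ∷ M) = cong (x ∷_) (map-head-zip l M)
  map-tail-zip : ∀ {m k} (l : Vec A k) (M : Vec (Vec A m) k) → Vec.map tail (zipWith _∷_ l M) ≡ M
  map-tail-zip []      []      = refl
  map-tail-zip (_ ∷ l) (v ∷ M) = cong (v ∷_) (map-tail-zip l M)
  zip-map-head-tail : ∀ {m k} (V : Vec (Vec A (suc m)) k) → zipWith _∷_ (Vec.map head V) (Vec.map tail V) ≡ V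
  zip-map-head-tail []           = refl
  zip-map-head-tail ((x ∷ v) ∷ V) = cong ((x ∷ v) ∷_) (zip-map-head-tail V)

counts : ∀ {N k} → Vec (Vec Bool N) k → ℕ
counts []       = 0
counts (v ∷ vs) = count v + counts vs

weights : ∀ {N k} → Vec (Vec Bool N) k → ℕ
weights []       = 0
weights (v ∷ vs) = weightFrom 0 v + weights vs

counts-uncons : ∀ {N k} (V : Vec (Vec Bool (suc N)) k) →
  counts V ≡ count (Vec.map head V) + counts (Vec.map tail V)
counts-uncons []            = refl
counts-uncons ((b ∷ v) ∷ V) = trans (cong (λ c → b · 1 + count v + c) (counts-uncons V))
  (+-interchange (b · 1) (count v) (count (Vec.map head V)) (counts (Vec.map tail V)))

weights-uncons : ∀ {N k} (V : Vec (Vec Bool (suc N)) k) →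
  weights V ≡ N * count (Vec.map head V) + weights (Vec.map tail V)
weights-uncons {N} []            = cong (_+ 0) (sym (*-zeroʳ N))
weights-uncons {N} ((b ∷ v) ∷ V) = begin
  b · N + weightFrom 0 v + weights V
    ≡⟨ cong₂ (λ x y → x + weightFrom 0 v + y) (·-as-* b N) (weights-uncons V) ⟩
  N * (b · 1) + weightFrom 0 v + (N * count (Vec.map head V) + weights (Vec.map tail V))
    ≡⟨ +-interchange (N * (b · 1)) (weightFrom 0 v) (N * count (Vec.map head V)) (weights (Vec.map tail V)) ⟩
  (N * (b · 1) + N * count (Vec.map head V)) + (weightFrom 0 v + weights (Vec.map tail V))
    ≡⟨ cong (_+ (weightFrom 0 v + weights (Vec.map tail V))) (*-distribˡ-+ N (b · 1) _) ⟨
  N * (b · 1 + count (Vec.map head V)) + (weightFrom 0 v + weights (Vec.map tail V))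
    ∎
  where open ≡-Reasoning

-- A sorted row with entries below N is the same as, for each colour, the set of its values.
SortedRow-columns : ∀ {k} N → SortedRow k N 0 ↔ Vec (Vec Bool N) k
SortedRow-columns {k} zero = mk↔ₛ′ (λ _ → replicate k []) (λ _ → []) (λ V → sym (all-empty V))
  (λ { [] → refl ; (cons _ _ _ _ (inj₁ ()) _) ; (cons _ _ _ _ (inj₂ (_ , ())) _) })
  where
  all-empty : ∀ {k} (V : Vec (Vec A 0) k) → V ≡ replicate k []
  all-empty []       = refl
  all-empty ([] ∷ V) = cong ([] ∷_) (all-empty V)
SortedRow-columns {k} (suc N) =
  SortedRow-lower N ⨾ SortedRow-layer N k ≤-refl ⨾ ↔-refl ×-↔ SortedRow-columns N ⨾ ↔-sym uncons-columns

size-columns : ∀ {k} N (V : Vec (Vec Bool N) k) → size (from (SortedRow-columns N) V) ≡ counts V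
size-columns zero    V = sym (counts-nil V)
  where
  counts-nil : ∀ {k} (V : Vec (Vec Bool 0) k) → counts V ≡ 0
  counts-nil []       = refl
  counts-nil ([] ∷ V) = counts-nil V
size-columns {k} (suc N) V = begin
  size (from (SortedRow-columns (suc N)) V)          ≡⟨ size-rebound _ layered ⟩
  size layered                                       ≡⟨ size-layer N k ≤-refl _ _ ⟩
  count (Vec.map head V) + size rest                 ≡⟨ cong (_+_ _) (size-columns N _) ⟩
  count (Vec.map head V) + counts (Vec.map tail V)   ≡⟨ counts-uncons V ⟨
  counts V                                           ∎
  where
  open ≡-Reasoning
  rest : SortedRow k N 0
  rest = from (SortedRow-columns N) (Vec.map tail V)
  layered : SortedRow k N k
  layered = from (SortedRow-layer N k ≤-refl) (Vec.map head V , rest)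

total-columns : ∀ {k} N (V : Vec (Vec Bool N) k) → total (from (SortedRow-columns N) V) ≡ weights V
total-columns zero    V = sym (weights-nil V)
  where
  weights-nil : ∀ {k} (V : Vec (Vec Bool 0) k) → weights V ≡ 0
  weights-nil []       = refl
  weights-nil ([] ∷ V) = weights-nil V
total-columns {k} (suc N) V = begin
  total (from (SortedRow-columns (suc N)) V)              ≡⟨ total-rebound _ layered ⟩
  total layered                                           ≡⟨ total-layer N k ≤-refl _ _ ⟩
  N * count (Vec.map head V) + total rest                 ≡⟨ cong (_+_ _) (total-columns N _) ⟩
  N * count (Vec.map head V) + weights (Vec.map tail V)   ≡⟨ weights-uncons V ⟨
  weights V                                               ∎
  where
  open ≡-Reasoning
  rest : SortedRow k N 0
  rest = from (SortedRow-columns N) (Vec.map tail V)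
  layered : SortedRow k N k
  layered = from (SortedRow-layer N k ≤-refl) (Vec.map head V , rest)

-- 2(r - s) + k, the doubled ζ-exponent of an F-partition with rows of lengths r and s.
fcharge : ℕ → ℕ → ℕ → ℤ
fcharge k r s = + (2 * r + k) ℤ.- + (2 * s)

RowPairs : (R : Set) → (R → ℕ) → (R → ℕ) → ℕ → Graded
RowPairs R len sum k = record
  { Carrier = R × R
  ; charge  = λ (t , b) → fcharge k (len t) (len b)
  ; weight  = λ (t , b) → len t + sum t + sum b
  }

RowPairs-↔ : ∀ {R R′ len sum len′ sum′ k e n} (f : R ↔ R′) →
  (∀ r → len′ (to f r) ≡ len r) → (∀ r → sum′ (to f r) ≡ sum r) →
  Fibre (RowPairs R len sum k) e n ↔ Fibre (RowPairs R′ len′ sum′ k) e n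
RowPairs-↔ {k = k} f len-to sum-to = Fibre-↔ (f ×-↔ f)
  (λ (t , b) → cong₂ (fcharge k) (len-to t) (len-to b))
  (λ (t , b) → cong₂ _+_ (cong₂ _+_ (len-to t) (sum-to t)) (sum-to b))

∸-↔ : ∀ x y z → (x ≡ y + z) ↔ (+ x ℤ.- + y ≡ + z)
∸-↔ x y z = ↔-irrelevant (λ { refl → cancel (+ y) (+ z) })
  (λ eq → ℤ.+-injective (trans (uncancel (+ x) (+ y)) (cong (λ d → + y ℤ.+ d) eq))) uip uip
  where
  cancel : ∀ a b → (a ℤ.+ b) ℤ.- a ≡ b
  cancel = solve-∀
  uncancel : ∀ a b → a ≡ b ℤ.+ (a ℤ.- b)
  uncancel = solve-∀

rowSum-bound : ∀ {k n} (xs : List (ColInt k)) → rowSum xs ≤ n → HeadBelow (suc n) 0 xs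
rowSum-bound []            _ = tt
rowSum-bound ((m , _) ∷ xs) ≤n = inj₁ (s≤s (≤-trans (m≤m+n m (rowSum xs)) ≤n))

FPart↔RowPairs : ∀ k a2 n →
  FPart k a2 n ↔ Fibre (RowPairs (BoundedRow k (suc n) 0) (length ∘ proj₁) (rowSum ∘ proj₁) k) (+ a2) n
FPart↔RowPairs k a2 n = mk↔ₛ′ forth back
  (λ { (((t , td , h) , (b , bd , h′)) , cw) →
       cong₂ (λ (h , h′) cw → ((t , td , h) , (b , bd , h′)) , cw)
             (cong₂ _,_ (HeadBelow-irrelevant t _ h) (HeadBelow-irrelevant b _ h′)) (≡×≡-irrelevant _ cw) })
  (λ p → cong (λ bal → record p { balance = bal }) (uip _ _))
  where
  balance-↔ : ∀ r s → (2 * r + k ≡ 2 * s + a2) ↔ (fcharge k r s ≡ + a2)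
  balance-↔ r s = ∸-↔ (2 * r + k) (2 * s) a2
  forth : FPart k a2 n → _
  forth p = ((top , topDec , rowSum-bound top top≤n) , (bottom , botDec , rowSum-bound bottom bottom≤n)) ,
            to (balance-↔ (length top) (length bottom)) balance , FPart.weight p
    where
    open FPart p using (top; bottom; topDec; botDec; balance)
    top≤n : rowSum top ≤ n
    top≤n = ≤-trans (m≤n+m _ (length top)) (≤-trans (m≤m+n _ (rowSum bottom)) (≤-reflexive (FPart.weight p)))
    bottom≤n : rowSum bottom ≤ n
    bottom≤n = ≤-trans (m≤n+m _ (length top + rowSum top)) (≤-reflexive (FPart.weight p))
  back : Fibre (RowPairs (BoundedRow k (suc n) 0) (length ∘ proj₁) (rowSum ∘ proj₁) k) (+ a2) n → FPart k a2 n
  back (((t , td , _) , (b , bd , _)) , ch , wt) = record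
    { top = t ; bottom = b ; topDec = td ; botDec = bd
    ; balance = from (balance-↔ (length t) (length b)) ch ; weight = wt }

odd-≡ : ∀ c → odd c ≡ + 1 ℤ.+ (c ℤ.+ c)
odd-≡ (+ m)    = cong (λ n → + suc (m + n)) (+-identityʳ m)
odd-≡ -[1+ m ] = doubled-negative (+ m)
  where
  doubled-negative : ∀ m → ℤ.- (+ 1 ℤ.+ (m ℤ.+ (m ℤ.+ + 0))) ≡ + 1 ℤ.+ (ℤ.- (+ 1 ℤ.+ m) ℤ.+ ℤ.- (+ 1 ℤ.+ m))
  doubled-negative = solve-∀

Σcharge-Colours : ∀ {N k} (As Bs : Vec (Vec Bool N) k) →
  Σcharge (Doubled (Window N N)) (Vec.zip As Bs) ≡ fcharge k (counts As) (counts Bs)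
Σcharge-Colours []       []       = refl
Σcharge-Colours {k = suc k} (A ∷ As) (B ∷ Bs) =
  trans (cong₂ ℤ._+_ (odd-≡ (+ count A ℤ.- + count B)) (Σcharge-Colours As Bs))
        (regroup (+ count A) (+ count B) (+ counts As) (+ counts Bs) (+ k))
  where
  regroup : ∀ a b p q k →
    (+ 1 ℤ.+ ((a ℤ.- b) ℤ.+ (a ℤ.- b))) ℤ.+ (((p ℤ.+ (p ℤ.+ + 0)) ℤ.+ k) ℤ.- (q ℤ.+ (q ℤ.+ + 0))) ≡
    (((a ℤ.+ p) ℤ.+ ((a ℤ.+ p) ℤ.+ + 0)) ℤ.+ (+ 1 ℤ.+ k)) ℤ.- ((b ℤ.+ q) ℤ.+ ((b ℤ.+ q) ℤ.+ + 0))
  regroup = solve-∀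

Σweight-Colours : ∀ {N k} (As Bs : Vec (Vec Bool N) k) →
  Σweight (Doubled (Window N N)) (Vec.zip As Bs) ≡ counts As + weights As + weights Bs
Σweight-Colours []       []       = refl
Σweight-Colours (A ∷ As) (B ∷ Bs) =
  trans (cong₂ (λ a rest → a + weightFrom 0 B + rest) (weightFrom-suc 0 A) (Σweight-Colours As Bs))
        (regroup (weightFrom 0 A) (count A) (weightFrom 0 B) (counts As) (weights As) (weights Bs))
  where
  regroup : ∀ a c b p q r → (a + c + b) + (p + q + r) ≡ (c + p) + (a + q) + (b + r)
  regroup = ℕ-Ring.solve-∀

FPart↔Colours : ∀ k a2 n → FPart k a2 n ↔ Fibre (Doubled (Window (suc n) (suc n)) ⊗^ k) (+ a2) n
FPart↔Colours k a2 n =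
  FPart↔RowPairs k a2 n ⨾
  RowPairs-↔ {len′ = size} {sum′ = total} (BoundedRow↔SortedRow (suc n) 0)
    (λ (xs , rs , h) → size-toSorted (suc n) 0 xs rs h) (λ (xs , rs , h) → total-toSorted (suc n) 0 xs rs h) ⨾
  ↔-sym (RowPairs-↔ {len′ = size} {sum′ = total} (↔-sym (SortedRow-columns (suc n)))
           (size-columns (suc n)) (total-columns (suc n))) ⨾
  Fibre-↔ ×v↔v× (λ (As , Bs) → Σcharge-Colours As Bs) (λ (As , Bs) → Σweight-Colours As Bs)

FPart↔Fcoeff : ∀ k a2 n → FPart k a2 n ↔ Fin (Fcoeff k a2 n)
FPart↔Fcoeff k a2 n =
  FPart↔Colours k a2 n ⨾
  Fibre-⊗^-↔ n (λ e w w≤n → Colour-Jacobi (suc n) e w (s≤s w≤n)) k (+ a2) n ≤-refl ⨾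
  ↔-sym (Fin-Fcoeff k a2 n)

CFrob↔FPart : ∀ k n → CFrob k n ↔ FPart k k n
CFrob↔FPart k n = mk↔ₛ′ forth back
  (λ p → cong (λ bal → record p { balance = bal }) (uip _ _))
  (λ c → cong (λ bal → record c { balance = bal }) (uip _ _))
  where
  forth : CFrob k n → FPart k k n
  forth c = record { CFrob c ; balance = cong (λ r → 2 * r + k) (CFrob.balance c) }
  back : FPart k k n → CFrob k n
  back p = record { FPart p ; balance = *-cancelˡ-≡ _ _ 2 (+-cancelʳ-≡ k _ _ (FPart.balance p)) }

theorem1 : (k : ℕ) → 1 ≤ k →
    ((a2 : ℕ) → a2 % 2 ≡ k % 2 → (n : ℕ) → FPart k a2 n ↔ Fin (Fcoeff k a2 n))
    × ((n : ℕ) → CFrob k n ↔ Fin (Fcoeff k k n))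
theorem1 k _ = (λ a2 _ n → FPart↔Fcoeff k a2 n) , (λ n → CFrob↔FPart k n ⨾ FPart↔Fcoeff k k n)
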